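{- Let $\textbf{while } \phi \textbf{ do } \mathbf{x}\leftarrow A\mathbf{x}+\mathbf{a}$ be a triangular loop, let $\mathbf{q}\in\mathbb{PE}[\mathbf{x}]^d$ be a closed form of the chained loop $\textbf{while } \phi\wedge\phi[\mathbf{x}/A\mathbf{x}+\mathbf{a}] \textbf{ do } \mathbf{x}\leftarrow A^2\mathbf{x}+A\mathbf{a}+\mathbf{a}$, let $\mathbf{q}_{norm}$ be its normalization, and write $(\phi\wedge\phi[\mathbf{x}/A\mathbf{x}+\mathbf{a}])[\mathbf{x}/\mathbf{q}_{norm}]=\bigwedge_{i=1}^{k}p_i>0$ with $p_i\in\mathbb{NPE}[\mathbf{x}]$. Then $\mathbf{c}\in\mathbb{Z}^d$ witnesses eventual non-termination of the original loop $\textbf{while } \phi \textbf{ do } \mathbf{x}\leftarrow A\mathbf{x}+\mathbf{a}$ if and only if $[\mathbf{x}/\mathbf{c}]$ is a model of $\bigwedge_{i=1}^{k}\mathrm{lia}(p_i)$.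
   Context: Loops: $A\in\mathbb{Z}^{d\times d}$ triangular (upper or lower), $\mathbf{a}\in\mathbb{Z}^d$, $\mathbf{x}=(x_1,\dots,x_d)$ pairwise different variables, $\phi$ a conjunction of inequalities $\alpha>0$ with $\alpha$ affine with rational coefficients over $\mathbf{x}$; update $f(\mathbf{x})=A\mathbf{x}+\mathbf{a}$. A vector $\mathbf{c}\in\mathbb{Z}^d$ witnesses eventual non-termination of the loop if $\exists n_0\in\mathbb{N}.\ \forall n\in\mathbb{N}_{>n_0}.\ \phi[\mathbf{x}/f^n(\mathbf{c})]$. $n$ is a designated variable over $\mathbb{N}$. $\mathbb{PE}[\mathbf{x}]$ is the set of expressions $\sum_{j}[\![\psi_j]\!]\cdot\alpha_j\cdot n^{a_j}\cdot b_j^n$ with $a_j\in\mathbb{N}$, $b_j\in\mathbb{N}_{\ge1}$, $\alpha_j$ affine over $\mathbf{x}$ with rational coefficients, $\psi_j$ a finite conjunction of literals $n=c$, $n\ne c$ ($c\in\mathbb{N}$) and $[\![\psi_j]\!]$ its characteristic function. A closed form of a loop with update $g$ is $\mathbf{q}\in\mathbb{PE}[\mathbf{x}]^d$ with $\mathbf{q}[n/c]=g^c(\mathbf{x})$ for all $c\in\mathbb{N}$. The normalization $\mathbf{q}_{norm}$ is obtained by deleting all addends $[\![\psi]\!]\alpha n^a b^n$ whose $\psi$ contains a literal of the form $n=c$, and replacing each remaining addend $[\![\psi]\!]\alpha n^a b^n$ by $\alpha n^a b^n$. $\mathbb{NPE}[\mathbf{x}]$ is the set of expressions $\sum_j\alpha_j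 n^{a_j}b_j^n$ with $\alpha_j$ affine over $\mathbf{x}$, $a_j\in\mathbb{N}$, $b_j\in\mathbb{N}_{\ge1}$, pairs $(b_j,a_j)$ pairwise distinct. For $p=\sum_{j=1}^{\ell}\alpha_j n^{a_j}b_j^n\in\mathbb{NPE}[\mathbf{x}]$ with all $\alpha_j\ne0$ and indices ordered so that $(b_1,a_1)>_{lex}(b_2,a_2)>_{lex}\dots>_{lex}(b_\ell,a_\ell)$ (lexicographic order), define $\mathrm{lia}(p)=\bigvee_{j=1}^{\ell}\big(\alpha_j>0\wedge\bigwedge_{i=1}^{j-1}\alpha_i=0\big)$ (for $\ell=0$ this is the false formula $0>0$). -}

module Defs where

open import Data.Nat as ℕ using (ℕ; zero; suc)
open import Data.Integer as ℤ using (ℤ; +_)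
open import Data.Rational as ℚ using (ℚ; 0ℚ; 1ℚ; _/_)
open import Data.Fin as Fin using (Fin; zero; suc)
open import Data.Bool using (Bool; true; false; if_then_else_; _∧_)
open import Data.List using (List; []; _∷_; length; _++_; map; lookup)
open import Data.Bool.ListAction using (any; all)
open import Data.List.Relation.Unary.All using (All)
open import Data.List.Relation.Unary.Linked using (Linked)
open import Data.Product using (Σ; ∃; _×_; _,_)
open import Data.Sum using (_⊎_)
open import Relation.Binary.PropositionalEquality using (_≡_)
open import Relation.Nullary using (¬_)

Vecℤ : ℕ → Set
Vecℤ d = Fin d → ℤ

Vecℚ : ℕ → Set
Vecℚ d = Fin d → ℚ

Mat : ℕ → Set
Mat d = Fin d → Fin d → ℤ

sumℤ : ∀ {d} → (Fin d → ℤ) → ℤ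
sumℤ {zero}  f = + 0
sumℤ {suc d} f = f zero ℤ.+ sumℤ (λ i → f (suc i))

sumℚ : ∀ {d} → (Fin d → ℚ) → ℚ
sumℚ {zero}  f = 0ℚ
sumℚ {suc d} f = f zero ℚ.+ sumℚ (λ i → f (suc i))

sumListℚ : List ℚ → ℚ
sumListℚ []       = 0ℚ
sumListℚ (q ∷ qs) = q ℚ.+ sumListℚ qs

ℤ→ℚ : ℤ → ℚ
ℤ→ℚ z = z / 1

ℕ→ℚ : ℕ → ℚ
ℕ→ℚ n = + n / 1

castVec : ∀ {d} → Vecℤ d → Vecℚ d
castVec c i = ℤ→ℚ (c i)

mulMV : ∀ {d} → Mat d → Vecℤ d → Vecℤ d
mulMV A x i = sumℤ (λ j → A i j ℤ.* x j)

mulMM : ∀ {d} → Mat d → Mat d → Mat d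
mulMM A B i j = sumℤ (λ k → A i k ℤ.* B k j)

UpperTriangular : ∀ {d} → Mat d → Set
UpperTriangular A = ∀ i j → j Fin.< i → A i j ≡ + 0

LowerTriangular : ∀ {d} → Mat d → Set
LowerTriangular A = ∀ i j → i Fin.< j → A i j ≡ + 0

Triangular : ∀ {d} → Mat d → Set
Triangular A = UpperTriangular A ⊎ LowerTriangular A

iter : ∀ {A : Set} → (A → A) → ℕ → A → A
iter f zero    x = x
iter f (suc n) x = f (iter f n x)

record Aff (d : ℕ) : Set where
  constructor aff
  field
    coef  : Fin d → ℚ
    const : ℚ
open Aff public

evalAff : ∀ {d} → Aff d → Vecℚ d → ℚ
evalAff α x = sumℚ (λ j → coef α j ℚ.* x j) ℚ.+ const α

AffZero : ∀ {d} → Aff d → Set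
AffZero α = (∀ j → coef α j ≡ 0ℚ) × (const α ≡ 0ℚ)

-- guard: conjunction of inequalities α > 0, given as list of the α's
Guard : ℕ → Set
Guard d = List (Aff d)

Holds : ∀ {d} → Guard d → Vecℚ d → Set
Holds φ x = All (λ α → 0ℚ ℚ.< evalAff α x) φ

update : ∀ {d} → Mat d → Vecℤ d → Vecℤ d → Vecℤ d
update A a x i = mulMV A x i ℤ.+ a i

WitnessesENT : ∀ {d} → Mat d → Vecℤ d → Guard d → Vecℤ d → Set
WitnessesENT A a φ c =
  ∃ λ n₀ → ∀ n → n₀ ℕ.< n → Holds φ (castVec (iter (update A a) n c))

substAff : ∀ {d} → Mat d → Vecℤ d → Aff d → Aff d
substAff A a α =
  aff (λ j → sumℚ (λ i → coef α i ℚ.* ℤ→ℚ (A i j)))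
      (sumℚ (λ i → coef α i ℚ.* ℤ→ℚ (a i)) ℚ.+ const α)

chainedGuard : ∀ {d} → Mat d → Vecℤ d → Guard d → Guard d
chainedGuard A a φ = φ ++ map (substAff A a) φ

-- x ↦ A²x + Aa + a, on ℚ^d (the variables of a closed form range over ℚ)
chainedUpdate : ∀ {d} → Mat d → Vecℤ d → Vecℚ d → Vecℚ d
chainedUpdate A a x i =
  sumℚ (λ j → ℤ→ℚ (mulMM A A i j) ℚ.* x j) ℚ.+ ℤ→ℚ (mulMV A a i ℤ.+ a i)

data Lit : Set where
  n≐ : ℕ → Lit
  n≠ : ℕ → Lit

litHolds : Lit → ℕ → Bool
litHolds (n≐ c) n = n ℕ.≡ᵇ c
litHolds (n≠ c) n = if n ℕ.≡ᵇ c then false else true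

isEqLit : Lit → Bool
isEqLit (n≐ _) = true
isEqLit (n≠ _) = false

charFun : List Lit → ℕ → ℚ
charFun ψ n = if all (λ l → litHolds l n) ψ then 1ℚ else 0ℚ

record PETerm (d : ℕ) : Set where
  constructor peTerm
  field
    cond    : List Lit
    pcoeff  : Aff d
    ppow    : ℕ
    pbase   : ℕ
    pbase≥1 : 1 ℕ.≤ pbase
open PETerm public

PE : ℕ → Set
PE d = List (PETerm d)

evalPE : ∀ {d} → PE d → Vecℚ d → ℕ → ℚ
evalPE p x n =
  sumListℚ (map (λ t → charFun (cond t) n ℚ.* evalAff (pcoeff t) x
                          ℚ.* ℕ→ℚ (n ℕ.^ ppow t ℕ.* pbase t ℕ.^ n)) p)

ClosedForm : ∀ {d} → (Vecℚ d → Vecℚ d) → (Fin d → PE d) → Set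
ClosedForm {d} g q = ∀ (c : ℕ) (x : Vecℚ d) (i : Fin d) → evalPE (q i) x c ≡ iter g c x i

record NPETerm (d : ℕ) : Set where
  constructor npeTerm
  field
    coeff   : Aff d
    pow     : ℕ
    base    : ℕ
    base≥1  : 1 ℕ.≤ base
open NPETerm public

NPE : ℕ → Set
NPE d = List (NPETerm d)

evalNPE : ∀ {d} → NPE d → Vecℚ d → ℕ → ℚ
evalNPE p x n =
  sumListℚ (map (λ t → evalAff (coeff t) x ℚ.* ℕ→ℚ (n ℕ.^ pow t ℕ.* base t ℕ.^ n)) p)

normalize : ∀ {d} → PE d → NPE d
normalize [] = []
normalize (t ∷ ts) =
  if any isEqLit (cond t) then normalize ts
  else npeTerm (pcoeff t) (ppow t) (pbase t) (pbase≥1 t) ∷ normalize ts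

_>lex_ : ∀ {d} → NPETerm d → NPETerm d → Set
s >lex t = (base t ℕ.< base s) ⊎ ((base s ≡ base t) × (pow t ℕ.< pow s))

OrderedNPE : ∀ {d} → NPE d → Set
OrderedNPE p = All (λ t → ¬ AffZero (coeff t)) p × Linked _>lex_ p

Lia : ∀ {d} → NPE d → Vecℚ d → Set
Lia p x =
  Σ (Fin (length p)) λ j →
    (0ℚ ℚ.< evalAff (coeff (lookup p j)) x)
    × (∀ i → i Fin.< j → evalAff (coeff (lookup p i)) x ≡ 0ℚ)

module Submission where

open import Defs
open import Data.Nat using (ℕ)
open import Data.Fin using (Fin)
open import Data.List using (length; lookup)
open import Function.Bundles using (_⇔_)
open import Relation.Binary.PropositionalEquality using (_≡_)

-- Proof.  (1) Orbits: c is a witness iff the chained orbit (the even iterates)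
-- eventually satisfies the chained guard, since a condition holds for all large
-- n iff it holds for all large even and odd n (module Orbits, built on the
-- rational reading of the loop in LoopSemantics).  (2) For large n the
-- normalized closed form is exact (module Normalization), so each atom of the
-- chained guard on the chained orbit at step n equals pᵢ(c)(n).  (3) Sign lemma
-- (module SignOfNPE): an NPE expression ordered lexicographically by (bᵢ, aᵢ) is
-- eventually positive iff its first non-vanishing coefficient is positive,
-- i.e. iff lia holds; this rests on the domination of smaller monomials
-- n^a b^n by larger ones (module Asymptotics) and on elementary estimates in ℚ
-- (module IntegersInRationals).
-- The triangularity of A is needed only for the existence of closed forms,
-- which is a hypothesis here.

module Asymptotics where

  open import Data.Nat
  open import Data.Nat.Properties
  open import Data.Nat.Tactic.RingSolver using (solve-∀)
  open import Data.Fin using (Fin; zero; suc)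
  open import Data.List using (List; []; _∷_)
  open import Data.List.Relation.Unary.All using (All; []; _∷_)
  open import Data.Product using (Σ; _,_; _×_)
  open import Data.Sum using (inj₁; inj₂)
  open import Relation.Binary.PropositionalEquality
  open import Relation.Binary.Definitions using (Transitive)

  Eventually : (ℕ → Set) → Set
  Eventually P = Σ ℕ λ N → ∀ n → N ≤ n → P n

  ev-map : ∀ {P Q : ℕ → Set} → (∀ n → P n → Q n) → Eventually P → Eventually Q
  ev-map f (N , h) = N , λ n N≤n → f n (h n N≤n)

  ev-and : ∀ {P Q : ℕ → Set} → Eventually P → Eventually Q → Eventually (λ n → P n × Q n)
  ev-and (N , h) (M , g) =
    N ⊔ M , λ n le → h n (≤-trans (m≤m⊔n N M) le) , g n (≤-trans (m≤n⊔m N M) le)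

  ev-large : ∀ M → Eventually (M ≤_)
  ev-large M = M , λ n M≤n → M≤n

  ev-all : ∀ {m} {P : Fin m → ℕ → Set} → (∀ i → Eventually (P i)) → Eventually (λ n → ∀ i → P i n)
  ev-all {zero} h = 0 , λ n _ ()
  ev-all {suc m} {P} h =
    ev-map join (ev-and (h zero) (ev-all {m} {λ i → P (suc i)} (λ i → h (suc i))))
    where
    join : ∀ n → P zero n × (∀ i → P (suc i) n) → ∀ i → P i n
    join n (p , ps) zero    = p
    join n (p , ps) (suc i) = ps i

  growth : ℕ → ℕ → ℕ → ℕ
  growth A c n = n ^ A * c ^ n

  shift-bound : ∀ A m → suc m * suc (suc m) ^ A ≤ suc m ^ suc A + 3 ^ A * suc m ^ A
  shift-bound zero m = m≤m+n (suc m * 1) 1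
  shift-bound (suc A) m = begin
      suc m * (suc (suc m) * suc (suc m) ^ A)     ≡⟨ e₁ (suc m) (suc (suc m) ^ A) ⟩
      suc (suc m) * (suc m * suc (suc m) ^ A)     ≤⟨ *-monoʳ-≤ (suc (suc m)) (shift-bound A m) ⟩
      suc (suc m) * (suc m * P + T * P)           ≡⟨ e₂ (suc m) P T ⟩
      suc m * Q + (Q + (T * Q + T * P))           ≤⟨ +-monoʳ-≤ (suc m * Q) rest ⟩
      suc m * Q + 3 * T * Q                       ∎
    where
    open ≤-Reasoning
    P Q T : ℕ
    P = suc m ^ A
    Q = suc m * P
    T = 3 ^ A
    e₁ : ∀ x y → x * ((1 + x) * y) ≡ (1 + x) * (x * y)
    e₁ = solve-∀
    e₂ : ∀ x p t → (1 + x) * (x * p + t * p) ≡ x * (x * p) + (x * p + (t * (x * p) + t * p))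
    e₂ = solve-∀
    e₃ : ∀ t q → t * q + (t * q + t * q) ≡ 3 * t * q
    e₃ = solve-∀
    rest : Q + (T * Q + T * P) ≤ 3 * T * Q
    rest = begin
      Q + (T * Q + T * P)   ≤⟨ +-mono-≤ (m≤n*m Q T {{m^n≢0 3 A}}) (+-monoʳ-≤ (T * Q) (*-monoʳ-≤ T (m≤n*m P (suc m)))) ⟩
      T * Q + (T * Q + T * Q) ≡⟨ e₃ T Q ⟩
      3 * T * Q             ∎

  shift-ratio : ∀ A c m → c * 3 ^ A ≤ m → c * suc (suc m) ^ A ≤ suc c * suc m ^ A
  shift-ratio A c m c3ᴬ≤m = *-cancelˡ-≤ (suc m) (begin
      suc m * (c * suc (suc m) ^ A)               ≡⟨ e₁ (suc m) c (suc (suc m) ^ A) ⟩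
      c * (suc m * suc (suc m) ^ A)               ≤⟨ *-monoʳ-≤ c (shift-bound A m) ⟩
      c * (suc m ^ suc A + 3 ^ A * suc m ^ A)     ≡⟨ e₂ c (suc m ^ suc A) (3 ^ A) (suc m ^ A) ⟩
      c * suc m ^ suc A + c * 3 ^ A * suc m ^ A   ≤⟨ +-monoʳ-≤ (c * suc m ^ suc A) (*-monoˡ-≤ (suc m ^ A) (m≤n⇒m≤1+n c3ᴬ≤m)) ⟩
      c * (suc m * suc m ^ A) + suc m * suc m ^ A ≡⟨ e₃ c (suc m) (suc m ^ A) ⟩
      suc m * (suc c * suc m ^ A)                 ∎)
    where
    open ≤-Reasoning
    e₁ : ∀ x c y → x * (c * y) ≡ c * (x * y)
    e₁ = solve-∀
    e₂ : ∀ c p t q → c * (p + t * q) ≡ c * p + c * t * q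
    e₂ = solve-∀
    e₃ : ∀ c x p → c * (x * p) + x * p ≡ x * ((1 + c) * p)
    e₃ = solve-∀

  growth-step : ∀ A c n → suc (c * 3 ^ A) ≤ n → growth A c (suc n) ≤ suc c * growth A c n
  growth-step A c (suc m) (s≤s c3ᴬ≤m) = begin
      suc (suc m) ^ A * (c * c ^ suc m)   ≡⟨ e (suc (suc m) ^ A) c (c ^ suc m) ⟩
      c * suc (suc m) ^ A * c ^ suc m     ≤⟨ *-monoˡ-≤ (c ^ suc m) (shift-ratio A c m c3ᴬ≤m) ⟩
      suc c * suc m ^ A * c ^ suc m       ≡⟨ *-assoc (suc c) (suc m ^ A) (c ^ suc m) ⟩
      suc c * growth A c (suc m)          ∎
    where
    open ≤-Reasoning
    e : ∀ p c q → p * (c * q) ≡ c * p * q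
    e = solve-∀

  growth-iter : ∀ A c m → let N₀ = suc (c * 3 ^ A) in
                growth A c (N₀ + m) ≤ suc c ^ m * growth A c N₀
  growth-iter A c zero =
    ≤-reflexive (trans (cong (growth A c) (+-identityʳ _)) (sym (*-identityˡ _)))
  growth-iter A c (suc m) = begin
      growth A c (N₀ + suc m)                   ≡⟨ cong (growth A c) (+-suc N₀ m) ⟩
      growth A c (suc (N₀ + m))                 ≤⟨ growth-step A c (N₀ + m) (m≤m+n N₀ m) ⟩
      suc c * growth A c (N₀ + m)               ≤⟨ *-monoʳ-≤ (suc c) (growth-iter A c m) ⟩
      suc c * (suc c ^ m * growth A c N₀)       ≡⟨ *-assoc (suc c) (suc c ^ m) _ ⟨
      suc c ^ suc m * growth A c N₀             ∎
    where
    open ≤-Reasoning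
    N₀ : ℕ
    N₀ = suc (c * 3 ^ A)

  growth-bound : ∀ A c n → suc (c * 3 ^ A) ≤ n → growth A c n ≤ suc c ^ n * growth A c (suc (c * 3 ^ A))
  growth-bound A c n N₀≤n = begin
      growth A c n                   ≡⟨ cong (growth A c) (m+[n∸m]≡n N₀≤n) ⟨
      growth A c (N₀ + (n ∸ N₀))     ≤⟨ growth-iter A c (n ∸ N₀) ⟩
      suc c ^ (n ∸ N₀) * H           ≤⟨ *-monoˡ-≤ H (^-monoʳ-≤ (suc c) (m∸n≤m n N₀)) ⟩
      suc c ^ n * H                  ∎
    where
    open ≤-Reasoning
    N₀ H : ℕ
    N₀ = suc (c * 3 ^ A)
    H = growth A c N₀

  -- Exponentials dominate polynomials: K · n^a · c^n < (1+c)^n for large n.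
  -- Apply growth-bound with exponent 1+a: n · (K n^a c^n) ≤ K H (1+c)^n, and K H < n.
  exp-dominates-poly : ∀ c a K → Eventually (λ n → K * (n ^ a * c ^ n) < suc c ^ n)
  exp-dominates-poly c a K = N₀ ⊔ suc (K * H) , dominated
    where
    N₀ H : ℕ
    N₀ = suc (c * 3 ^ suc a)
    H = growth (suc a) c N₀
    dominated : ∀ n → N₀ ⊔ suc (K * H) ≤ n → K * (n ^ a * c ^ n) < suc c ^ n
    dominated n le = *-cancelˡ-< n _ _ (begin-strict
        n * (K * (n ^ a * c ^ n))   ≡⟨ e n K (n ^ a) (c ^ n) ⟩
        K * growth (suc a) c n      ≤⟨ *-monoʳ-≤ K (growth-bound (suc a) c n (≤-trans (m≤m⊔n N₀ (suc (K * H))) le)) ⟩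
        K * (E * H)                 ≡⟨ e′ K E H ⟩
        K * H * E                   <⟨ *-monoˡ-< E {{m^n≢0 (suc c) n}} (≤-trans (m≤n⊔m N₀ (suc (K * H))) le) ⟩
        n * E                       ∎)
      where
      open ≤-Reasoning
      E : ℕ
      E = suc c ^ n
      e : ∀ n K p q → n * (K * (p * q)) ≡ K * (n * p * q)
      e = solve-∀
      e′ : ∀ K E H → K * (E * H) ≡ K * H * E
      e′ = solve-∀

  monomial : ∀ {d} → NPETerm d → ℕ → ℕ
  monomial t = growth (pow t) (base t)

  base^n≢0 : ∀ {d} (t : NPETerm d) n → NonZero (base t ^ n)
  base^n≢0 t n = m^n≢0 (base t) n {{>-nonZero (base≥1 t)}}

  monomial>0 : ∀ {d} (t : NPETerm d) n → 1 ≤ n → 0 < monomial t n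
  monomial>0 t n@(suc _) _ = *-mono-< (m^n>0 n (pow t)) (>-nonZero⁻¹ _ {{base^n≢0 t n}})

  >lex-trans : ∀ {d} → Transitive (_>lex_ {d})
  >lex-trans (inj₁ b<b′) (inj₁ b′<b″)          = inj₁ (<-trans b′<b″ b<b′)
  >lex-trans (inj₁ b<b′) (inj₂ (b′≡b″ , _))    = inj₁ (subst (_< _) b′≡b″ b<b′)
  >lex-trans (inj₂ (b≡b′ , _)) (inj₁ b′<b″)    = inj₁ (subst (_ <_) (sym b≡b′) b′<b″)
  >lex-trans (inj₂ (b≡b′ , a<a′)) (inj₂ (b′≡b″ , a′<a″)) = inj₂ (trans b≡b′ b′≡b″ , <-trans a′<a″ a<a′)

  -- A lexicographically larger monomial dominates any constant multiple of a
  -- smaller one: a larger base wins by exp-dominates-poly, an equal base with a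
  -- larger power wins as soon as n > K.
  lex-dominates : ∀ {d} (s t : NPETerm d) → t >lex s → ∀ K → Eventually (λ n → K * monomial s n < monomial t n)
  lex-dominates s t (inj₁ bₛ<bₜ) K =
    ev-map larger-base (ev-and (ev-large 1) (exp-dominates-poly (base s) (pow s) K))
    where
    open ≤-Reasoning
    larger-base : ∀ n → 1 ≤ n × K * monomial s n < suc (base s) ^ n → K * monomial s n < monomial t n
    larger-base n@(suc _) (_ , dominated) = begin-strict
      K * monomial s n        <⟨ dominated ⟩
      suc (base s) ^ n        ≤⟨ ^-monoˡ-≤ n bₛ<bₜ ⟩
      base t ^ n              ≤⟨ m≤n*m (base t ^ n) (n ^ pow t) {{m^n≢0 n (pow t)}} ⟩
      monomial t n            ∎
  lex-dominates s t (inj₂ (bₜ≡bₛ , aₛ<aₜ)) K = suc K , larger-power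
    where
    open ≤-Reasoning
    larger-power : ∀ n → suc K ≤ n → K * monomial s n < monomial t n
    larger-power n@(suc _) K<n = begin-strict
      K * (n ^ pow s * base s ^ n)    ≡⟨ *-assoc K _ _ ⟨
      K * n ^ pow s * base s ^ n      <⟨ *-monoˡ-< (base s ^ n) {{base^n≢0 s n}} Knᵃ<nᵃ′ ⟩
      n ^ pow t * base s ^ n          ≡⟨ cong (λ b → n ^ pow t * b ^ n) bₜ≡bₛ ⟨
      monomial t n                    ∎
      where
      Knᵃ<nᵃ′ : K * n ^ pow s < n ^ pow t
      Knᵃ<nᵃ′ = begin-strict
        K * n ^ pow s      <⟨ *-monoˡ-< (n ^ pow s) {{m^n≢0 n (pow s)}} K<n ⟩
        n * n ^ pow s      ≤⟨ ^-monoʳ-≤ n aₛ<aₜ ⟩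
        n ^ pow t          ∎

  weightedSum : ∀ {d} → (NPETerm d → ℕ) → List (NPETerm d) → ℕ → ℕ
  weightedSum B []      n = 0
  weightedSum B (s ∷ r) n = B s * monomial s n + weightedSum B r n

  -- A monomial dominating every addend of r dominates every weighted sum over r.
  -- Each of the two parts is bounded by half of monomial t n.
  dominates-weightedSum : ∀ {d} (B : NPETerm d → ℕ) (t : NPETerm d) (r : List (NPETerm d)) →
    All (t >lex_) r → ∀ K → Eventually (λ n → K * weightedSum B r n < monomial t n)
  dominates-weightedSum B t [] [] K =
    1 , λ n 1≤n → subst (_< monomial t n) (sym (*-zeroʳ K)) (monomial>0 t n 1≤n)
  dominates-weightedSum B t (s ∷ r) (t>s ∷ t>r) K =
    ev-map halves (ev-and (lex-dominates s t t>s (2 * K * B s)) (dominates-weightedSum B t r t>r (2 * K)))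
    where
    e : ∀ K b T W → 2 * (K * (b * T + W)) ≡ 2 * K * b * T + 2 * K * W
    e = solve-∀
    halves : ∀ n → 2 * K * B s * monomial s n < monomial t n × 2 * K * weightedSum B r n < monomial t n →
             K * weightedSum B (s ∷ r) n < monomial t n
    halves n (head< , tail<) = *-cancelˡ-< 2 _ _ (begin-strict
        2 * (K * (B s * monomial s n + weightedSum B r n))      ≡⟨ e K (B s) (monomial s n) (weightedSum B r n) ⟩
        2 * K * B s * monomial s n + 2 * K * weightedSum B r n  <⟨ +-mono-< head< tail< ⟩
        monomial t n + monomial t n                             ≡⟨ cong (monomial t n +_) (+-identityʳ _) ⟨
        2 * monomial t n                                        ∎)
      where open ≤-Reasoning


module IntegersInRationals where

  open import Data.Nat as ℕ using (ℕ; suc)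
  import Data.Nat.Properties as ℕP
  open import Data.Integer as ℤ using (ℤ; +_; +[1+_]; -[1+_])
  import Data.Integer.Properties as ℤP
  open import Data.Rational as ℚ using (ℚ; 0ℚ; mkℚ; ↥_; ↧ₙ_)
  import Data.Rational.Properties as ℚP
  open import Data.Rational.Unnormalised as ℚᵘ using (mkℚᵘ)
  import Data.Rational.Unnormalised.Properties as ℚᵘP
  open import Data.Rational.Solver using (module +-*-Solver)
  open import Data.Sum using (inj₁; inj₂)
  open import Relation.Binary.PropositionalEquality

  ι : ℤ → ℚ
  ι = ℤ→ℚ

  toℚᵘ-ι : ∀ z → ℚᵘ._≃_ (ℚ.toℚᵘ (ι z)) (mkℚᵘ z 0)
  toℚᵘ-ι z = ℚP.toℚᵘ-fromℚᵘ (mkℚᵘ z 0)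

  ι-+ : ∀ x y → ι (x ℤ.+ y) ≡ ι x ℚ.+ ι y
  ι-+ x y = ℚP.toℚᵘ-injective (begin
      ℚ.toℚᵘ (ι (x ℤ.+ y))              ≈⟨ toℚᵘ-ι (x ℤ.+ y) ⟩
      mkℚᵘ (x ℤ.+ y) 0                  ≈⟨ ℚᵘ.*≡* (numerators x y) ⟩
      mkℚᵘ x 0 ℚᵘ.+ mkℚᵘ y 0            ≈⟨ ℚᵘP.+-cong (toℚᵘ-ι x) (toℚᵘ-ι y) ⟨
      ℚ.toℚᵘ (ι x) ℚᵘ.+ ℚ.toℚᵘ (ι y)    ≈⟨ ℚP.toℚᵘ-homo-+ (ι x) (ι y) ⟨
      ℚ.toℚᵘ (ι x ℚ.+ ι y)              ∎)
    where
    open ℚᵘP.≃-Reasoning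
    numerators : ∀ x y → (x ℤ.+ y) ℤ.* + 1 ≡ (x ℤ.* + 1 ℤ.+ y ℤ.* + 1) ℤ.* + 1
    numerators x y = cong (ℤ._* + 1) (sym (cong₂ ℤ._+_ (ℤP.*-identityʳ x) (ℤP.*-identityʳ y)))

  ι-* : ∀ x y → ι (x ℤ.* y) ≡ ι x ℚ.* ι y
  ι-* x y = ℚP.toℚᵘ-injective (begin
      ℚ.toℚᵘ (ι (x ℤ.* y))              ≈⟨ toℚᵘ-ι (x ℤ.* y) ⟩
      mkℚᵘ x 0 ℚᵘ.* mkℚᵘ y 0            ≈⟨ ℚᵘP.*-cong (toℚᵘ-ι x) (toℚᵘ-ι y) ⟨
      ℚ.toℚᵘ (ι x) ℚᵘ.* ℚ.toℚᵘ (ι y)    ≈⟨ ℚP.toℚᵘ-homo-* (ι x) (ι y) ⟨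
      ℚ.toℚᵘ (ι x ℚ.* ι y)              ∎)
    where open ℚᵘP.≃-Reasoning

  ι-nonNeg : ∀ m → 0ℚ ℚ.≤ ι (+ m)
  ι-nonNeg m = ℚP.nonNegative⁻¹ (ι (+ m)) {{ℚP.normalize-nonNeg m 1}}

  ∣q∣≤∣↥q∣ : ∀ q → ℚ.∣ q ∣ ℚ.≤ ι (+ ℤ.∣ ↥ q ∣)
  ∣q∣≤∣↥q∣ (mkℚ n d _) = ℚP.toℚᵘ-cancel-≤ (ℚᵘP.≤-respʳ-≃ (ℚᵘP.≃-sym (toℚᵘ-ι (+ ℤ.∣ n ∣))) (ℚᵘ.*≤* n≤nd))
    where
    n≤nd : + ℤ.∣ n ∣ ℤ.* + 1 ℤ.≤ + ℤ.∣ n ∣ ℤ.* + suc d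
    n≤nd = subst₂ ℤ._≤_ (ℤP.pos-* ℤ.∣ n ∣ 1) (ℤP.pos-* ℤ.∣ n ∣ (suc d))
             (ℤ.+≤+ (ℕP.*-monoʳ-≤ ℤ.∣ n ∣ (ℕ.s≤s ℕ.z≤n)))

  scaled-numerators : ∀ k d W T → suc d ℕ.* W ℕ.< T → W ℕ.* (suc d ℕ.* 1) ℕ.< suc k ℕ.* T ℕ.* 1
  scaled-numerators k d W T dW<T = begin-strict
      W ℕ.* (suc d ℕ.* 1)   ≡⟨ trans (cong (W ℕ.*_) (ℕP.*-identityʳ (suc d))) (ℕP.*-comm W (suc d)) ⟩
      suc d ℕ.* W           <⟨ dW<T ⟩
      T                     ≤⟨ ℕP.m≤n*m T (suc k) ⟩
      suc k ℕ.* T           ≡⟨ ℕP.*-identityʳ _ ⟨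
      suc k ℕ.* T ℕ.* 1     ∎
    where open ℕP.≤-Reasoning

  scale-dominates : ∀ u → 0ℚ ℚ.< u → ∀ W T → ↧ₙ u ℕ.* W ℕ.< T → ι (+ W) ℚ.< u ℚ.* ι (+ T)
  scale-dominates (mkℚ -[1+ _ ] _ _) (ℚ.*<* ()) W T _
  scale-dominates (mkℚ (+ 0) _ _) (ℚ.*<* (ℤ.+<+ ())) W T _
  scale-dominates u@(mkℚ +[1+ k ] d _) _ W T dW<T = ℚP.toℚᵘ-cancel-< (begin-strict
      ℚ.toℚᵘ (ι (+ W))               ≃⟨ toℚᵘ-ι (+ W) ⟩
      mkℚᵘ (+ W) 0                   <⟨ ℚᵘ.*<* (subst₂ ℤ._<_ (ℤP.pos-* W (suc d ℕ.* 1)) lhs (ℤ.+<+ (scaled-numerators k d W T dW<T))) ⟩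
      mkℚᵘ +[1+ k ] d ℚᵘ.* mkℚᵘ (+ T) 0 ≃⟨ ℚᵘP.*-congˡ {mkℚᵘ +[1+ k ] d} (toℚᵘ-ι (+ T)) ⟨
      ℚ.toℚᵘ u ℚᵘ.* ℚ.toℚᵘ (ι (+ T))   ≃⟨ ℚP.toℚᵘ-homo-* u (ι (+ T)) ⟨
      ℚ.toℚᵘ (u ℚ.* ι (+ T))         ∎)
    where
    open ℚᵘP.≤-Reasoning
    lhs : + (suc k ℕ.* T ℕ.* 1) ≡ +[1+ k ] ℤ.* + T ℤ.* + 1
    lhs = trans (ℤP.pos-* (suc k ℕ.* T) 1) (cong (ℤ._* + 1) (ℤP.pos-* (suc k) T))

  pos-if-dominated : ∀ a b → ℚ.∣ b ∣ ℚ.< a → 0ℚ ℚ.< a ℚ.+ b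
  pos-if-dominated a b ∣b∣<a with ℚP.∣p∣≡p∨∣p∣≡-p b
  ... | inj₁ ∣b∣≡b = ℚP.positive⁻¹ (a ℚ.+ b)
        {{ℚP.pos+nonNeg⇒pos a {{ℚ.positive (ℚP.≤-<-trans (ℚP.0≤∣p∣ b) ∣b∣<a)}} b
            {{ℚ.nonNegative (subst (0ℚ ℚ.≤_) ∣b∣≡b (ℚP.0≤∣p∣ b))}}}}
  ... | inj₂ ∣b∣≡-b = subst (ℚ._< a ℚ.+ b) (ℚP.+-inverseˡ b)
                        (ℚP.+-monoˡ-< b (subst (ℚ._< a) ∣b∣≡-b ∣b∣<a))

  neg-if-dominated : ∀ a b → ℚ.∣ b ∣ ℚ.< ℚ.- a → a ℚ.+ b ℚ.< 0ℚ
  neg-if-dominated a b ∣b∣<-a = subst (ℚ._< 0ℚ) (neg-neg-sum a b)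
    (ℚP.neg-antimono-< (pos-if-dominated (ℚ.- a) (ℚ.- b) (subst (ℚ._< ℚ.- a) (sym (ℚP.∣-p∣≡∣p∣ b)) ∣b∣<-a)))
    where
    open +-*-Solver
    neg-neg-sum : ∀ a b → ℚ.- (ℚ.- a ℚ.+ ℚ.- b) ≡ a ℚ.+ b
    neg-neg-sum = solve 2 (λ a b → :- (:- a :+ :- b) := a :+ b) refl


module SignOfNPE where

  open Asymptotics
  open IntegersInRationals
  open import Data.Nat as ℕ using (ℕ; zero; suc)
  import Data.Nat.Properties as ℕP
  open import Data.Integer as ℤ using (+_)
  import Data.Integer.Properties as ℤP
  open import Data.Rational as ℚ using (ℚ; 0ℚ; ↥_; ↧ₙ_)
  import Data.Rational.Properties as ℚP
  open import Data.Fin as Fin using (Fin; zero; suc)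
  open import Data.List using ([]; _∷_; length; lookup)
  open import Data.List.Relation.Unary.All using (All)
  open import Data.List.Relation.Unary.AllPairs using (AllPairs; []; _∷_)
  open import Data.Product using (_×_; _,_; proj₁; proj₂)
  open import Data.Empty using (⊥-elim)
  open import Function.Base using (_∘_)
  open import Function.Bundles using (_⇔_; mk⇔)
  import Function.Properties.Equivalence as ⇔
  open import Relation.Binary.PropositionalEquality
  open import Relation.Binary.Definitions using (Tri; tri<; tri≈; tri>)
  open import Relation.Nullary using (¬_)

  module _ {d : ℕ} (x : Vecℚ d) where

    coeffAt : NPETerm d → ℚ
    coeffAt t = evalAff (coeff t) x

    EventuallyPositive : NPE d → Set
    EventuallyPositive p = Eventually (λ n → 0ℚ ℚ.< evalNPE p x n)

    -- an integer bound |α_t(x)| ≤ weight t, to reduce to estimates over ℕ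
    weight : NPETerm d → ℕ
    weight t = ℤ.∣ ↥ coeffAt t ∣

    ∣evalNPE∣≤weightedSum : ∀ r n → ℚ.∣ evalNPE r x n ∣ ℚ.≤ ι (+ weightedSum weight r n)
    ∣evalNPE∣≤weightedSum []      n = ℚP.≤-refl
    ∣evalNPE∣≤weightedSum (s ∷ r) n = begin
        ℚ.∣ coeffAt s ℚ.* M ℚ.+ S ∣                     ≤⟨ ℚP.∣p+q∣≤∣p∣+∣q∣ (coeffAt s ℚ.* M) S ⟩
        ℚ.∣ coeffAt s ℚ.* M ∣ ℚ.+ ℚ.∣ S ∣                ≡⟨ cong (ℚ._+ ℚ.∣ S ∣) (ℚP.∣p*q∣≡∣p∣*∣q∣ (coeffAt s) M) ⟩
        ℚ.∣ coeffAt s ∣ ℚ.* ℚ.∣ M ∣ ℚ.+ ℚ.∣ S ∣          ≡⟨ cong (λ z → ℚ.∣ coeffAt s ∣ ℚ.* z ℚ.+ ℚ.∣ S ∣) (ℚP.0≤p⇒∣p∣≡p (ι-nonNeg (monomial s n))) ⟩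
        ℚ.∣ coeffAt s ∣ ℚ.* M ℚ.+ ℚ.∣ S ∣                ≤⟨ ℚP.+-mono-≤ (ℚP.*-monoʳ-≤-nonNeg M {{ℚ.nonNegative (ι-nonNeg (monomial s n))}} (∣q∣≤∣↥q∣ (coeffAt s)))
                                                                         (∣evalNPE∣≤weightedSum r n) ⟩
        ι (+ weight s) ℚ.* M ℚ.+ ι (+ weightedSum weight r n)  ≡⟨ ι-linear (weight s) (monomial s n) (weightedSum weight r n) ⟨
        ι (+ weightedSum weight (s ∷ r) n)              ∎
      where
      open ℚP.≤-Reasoning
      M S : ℚ
      M = ι (+ monomial s n)
      S = evalNPE r x n
      ι-linear : ∀ b m w → ι (+ (b ℕ.* m ℕ.+ w)) ≡ ι (+ b) ℚ.* ι (+ m) ℚ.+ ι (+ w)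
      ι-linear b m w = trans (ι-+ (+ (b ℕ.* m)) (+ w)) (cong (ℚ._+ ι (+ w)) (trans (cong ι (ℤP.pos-* b m)) (ι-* (+ b) (+ m))))

    tail-dominated : ∀ t r → All (t >lex_) r → ∀ u → 0ℚ ℚ.< u →
                     Eventually (λ n → ℚ.∣ evalNPE r x n ∣ ℚ.< u ℚ.* ι (+ monomial t n))
    tail-dominated t r t>r u u>0 =
      ev-map (λ n dom → ℚP.≤-<-trans (∣evalNPE∣≤weightedSum r n) (scale-dominates u u>0 (weightedSum weight r n) (monomial t n) dom))
             (dominates-weightedSum weight t r t>r (↧ₙ u))

    leading-positive : ∀ t r → All (t >lex_) r → 0ℚ ℚ.< coeffAt t → EventuallyPositive (t ∷ r)
    leading-positive t r t>r α>0 =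
      ev-map (λ n → pos-if-dominated (coeffAt t ℚ.* ι (+ monomial t n)) (evalNPE r x n)) (tail-dominated t r t>r (coeffAt t) α>0)

    leading-negative : ∀ t r → All (t >lex_) r → coeffAt t ℚ.< 0ℚ →
                       Eventually (λ n → evalNPE (t ∷ r) x n ℚ.< 0ℚ)
    leading-negative t r t>r α<0 =
      ev-map (λ n dom → neg-if-dominated (coeffAt t ℚ.* ι (+ monomial t n)) (evalNPE r x n)
                          (subst (ℚ.∣ evalNPE r x n ∣ ℚ.<_) (sym (ℚP.neg-distribˡ-* (coeffAt t) _)) dom))
             (tail-dominated t r t>r (ℚ.- coeffAt t) (ℚP.neg-antimono-< α<0))

    leading-zero : ∀ t r → coeffAt t ≡ 0ℚ → ∀ n → evalNPE (t ∷ r) x n ≡ evalNPE r x n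
    leading-zero t r α≡0 n = begin
        coeffAt t ℚ.* M ℚ.+ evalNPE r x n  ≡⟨ cong (λ α → α ℚ.* M ℚ.+ evalNPE r x n) α≡0 ⟩
        0ℚ ℚ.* M ℚ.+ evalNPE r x n         ≡⟨ cong (ℚ._+ evalNPE r x n) (ℚP.*-zeroˡ M) ⟩
        0ℚ ℚ.+ evalNPE r x n               ≡⟨ ℚP.+-identityˡ _ ⟩
        evalNPE r x n                      ∎
      where
      open ≡-Reasoning
      M : ℚ
      M = ι (+ monomial t n)

    lia-skip-zero : ∀ t r → coeffAt t ≡ 0ℚ → Lia (t ∷ r) x ⇔ Lia r x
    lia-skip-zero t r α≡0 = mk⇔ drop shift
      where
      drop : Lia (t ∷ r) x → Lia r x
      drop (zero , α>0 , _)        = ⊥-elim (ℚP.<-irrefl (sym α≡0) α>0)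
      drop (suc j , α>0 , earlier) = j , α>0 , λ i i<j → earlier (suc i) (ℕ.s≤s i<j)
      shift : Lia r x → Lia (t ∷ r) x
      shift (j , α>0 , earlier) = suc j , α>0 , vanish
        where
        vanish : ∀ (i : Fin (suc (length r))) → i Fin.< suc j → coeffAt (lookup (t ∷ r) i) ≡ 0ℚ
        vanish zero    _   = α≡0
        vanish (suc i) i<j = earlier i (ℕP.≤-pred i<j)

    negative-not-eventuallyPositive : ∀ t r → All (t >lex_) r → coeffAt t ℚ.< 0ℚ → ¬ EventuallyPositive (t ∷ r)
    negative-not-eventuallyPositive t r t>r α<0 pos = contradictory (ev-and pos (leading-negative t r t>r α<0))
      where
      contradictory : ¬ Eventually (λ n → 0ℚ ℚ.< evalNPE (t ∷ r) x n × evalNPE (t ∷ r) x n ℚ.< 0ℚ)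
      contradictory (N , both) = ℚP.<-asym (proj₁ (both N ℕP.≤-refl)) (proj₂ (both N ℕP.≤-refl))

    negative-not-lia : ∀ t r → coeffAt t ℚ.< 0ℚ → ¬ Lia (t ∷ r) x
    negative-not-lia t r α<0 (zero , α>0 , _)      = ℚP.<-asym α<0 α>0
    negative-not-lia t r α<0 (suc j , _ , earlier) = ℚP.<-irrefl (earlier zero (ℕ.s≤s ℕ.z≤n)) α<0

    eventuallyPositive⇔lia : ∀ p → AllPairs _>lex_ p → EventuallyPositive p ⇔ Lia p x
    eventuallyPositive⇔lia [] [] = mk⇔ (λ (N , pos) → ⊥-elim (ℚP.<-irrefl refl (pos N ℕP.≤-refl))) (λ ())
    eventuallyPositive⇔lia (t ∷ r) (t>r ∷ ordered) = by-leading-sign (ℚP.<-cmp (coeffAt t) 0ℚ)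
      where
      by-leading-sign : Tri (coeffAt t ℚ.< 0ℚ) (coeffAt t ≡ 0ℚ) (coeffAt t ℚ.> 0ℚ) →
                        EventuallyPositive (t ∷ r) ⇔ Lia (t ∷ r) x
      by-leading-sign (tri< α<0 _ _) =
        mk⇔ (⊥-elim ∘ negative-not-eventuallyPositive t r t>r α<0) (⊥-elim ∘ negative-not-lia t r α<0)
      by-leading-sign (tri≈ _ α≡0 _) =
        ⇔.trans skip-zero (⇔.trans (eventuallyPositive⇔lia r ordered) (⇔.sym (lia-skip-zero t r α≡0)))
        where
        skip-zero : EventuallyPositive (t ∷ r) ⇔ EventuallyPositive r
        skip-zero = mk⇔ (ev-map (λ n → subst (0ℚ ℚ.<_) (leading-zero t r α≡0 n)))
                        (ev-map (λ n → subst (0ℚ ℚ.<_) (sym (leading-zero t r α≡0 n))))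
      by-leading-sign (tri> _ _ α>0) =
        mk⇔ (λ _ → zero , α>0 , λ _ ()) (λ _ → leading-positive t r t>r α>0)


module Normalization where

  open Asymptotics using (Eventually)
  open import Data.Nat as ℕ using (ℕ; zero; suc; _⊔_)
  import Data.Nat.Properties as ℕP
  open import Data.Rational as ℚ using (ℚ; 0ℚ; 1ℚ)
  import Data.Rational.Properties as ℚP
  open import Data.Bool using (true; false; not; if_then_else_)
  open import Data.Bool.ListAction using (any; all)
  open import Data.List using (List; []; _∷_)
  open import Data.Product using (_,_)
  open import Relation.Binary.PropositionalEquality

  litBound : List Lit → ℕ
  litBound []           = 0
  litBound (n≐ c ∷ ψ) = c ⊔ litBound ψ
  litBound (n≠ c ∷ ψ) = c ⊔ litBound ψ

  ≡ᵇ-false : ∀ n c → c ℕ.< n → (n ℕ.≡ᵇ c) ≡ false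
  ≡ᵇ-false (suc n) zero    _             = refl
  ≡ᵇ-false (suc n) (suc c) (ℕ.s≤s c<n) = ≡ᵇ-false n c c<n

  holds-large : ∀ ψ n → litBound ψ ℕ.< n → all (λ l → litHolds l n) ψ ≡ not (any isEqLit ψ)
  holds-large []           n _  = refl
  holds-large (n≐ c ∷ ψ) n lt rewrite ≡ᵇ-false n c (ℕP.m⊔n<o⇒m<o c _ lt) = refl
  holds-large (n≠ c ∷ ψ) n lt rewrite ≡ᵇ-false n c (ℕP.m⊔n<o⇒m<o c _ lt) =
    holds-large ψ n (ℕP.m⊔n<o⇒n<o c _ lt)

  charFun-large : ∀ ψ n → litBound ψ ℕ.< n → charFun ψ n ≡ (if any isEqLit ψ then 0ℚ else 1ℚ)
  charFun-large ψ n lt rewrite holds-large ψ n lt with any isEqLit ψ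
  ... | true  = refl
  ... | false = refl

  peBound : ∀ {d} → PE d → ℕ
  peBound []       = 0
  peBound (t ∷ ts) = litBound (cond t) ⊔ peBound ts

  normalize-large : ∀ {d} (p : PE d) n → peBound p ℕ.< n → ∀ x → evalNPE (normalize p) x n ≡ evalPE p x n
  normalize-large []       n _  x = refl
  normalize-large (t ∷ ts) n lt x with any isEqLit (cond t) in eq | charFun-large (cond t) n (ℕP.m⊔n<o⇒m<o _ _ lt)
  ... | true  | χ≡0 = begin
      evalNPE (normalize ts) x n              ≡⟨ normalize-large ts n lt′ x ⟩
      evalPE ts x n                           ≡⟨ ℚP.+-identityˡ _ ⟨
      0ℚ ℚ.+ evalPE ts x n                    ≡⟨ cong (ℚ._+ evalPE ts x n) (trans (cong (ℚ._* M) (ℚP.*-zeroˡ α)) (ℚP.*-zeroˡ M)) ⟨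
      0ℚ ℚ.* α ℚ.* M ℚ.+ evalPE ts x n        ≡⟨ cong (λ χ → χ ℚ.* α ℚ.* M ℚ.+ evalPE ts x n) χ≡0 ⟨
      charFun (cond t) n ℚ.* α ℚ.* M ℚ.+ evalPE ts x n ∎
    where
    open ≡-Reasoning
    α M : ℚ
    α = evalAff (pcoeff t) x
    M = ℕ→ℚ (n ℕ.^ ppow t ℕ.* pbase t ℕ.^ n)
    lt′ : peBound ts ℕ.< n
    lt′ = ℕP.m⊔n<o⇒n<o (litBound (cond t)) _ lt
  ... | false | χ≡1 = cong₂ ℚ._+_ (sym (trans (cong (λ χ → χ ℚ.* α ℚ.* M) χ≡1) (cong (ℚ._* M) (ℚP.*-identityˡ α))))
                                  (normalize-large ts n lt′ x)
    where
    lt′ : peBound ts ℕ.< n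
    lt′ = ℕP.m⊔n<o⇒n<o (litBound (cond t)) _ lt
    α M : ℚ
    α = evalAff (pcoeff t) x
    M = ℕ→ℚ (n ℕ.^ ppow t ℕ.* pbase t ℕ.^ n)

  normalize-eventually : ∀ {d} (p : PE d) → Eventually (λ n → ∀ x → evalNPE (normalize p) x n ≡ evalPE p x n)
  normalize-eventually p = suc (peBound p) , normalize-large p


module LoopSemantics where

  open IntegersInRationals using (ι; ι-+; ι-*)
  open import Data.Nat using (zero; suc)
  open import Data.Integer as ℤ using (ℤ)
  open import Data.Rational as ℚ using (ℚ; 0ℚ)
  import Data.Rational.Properties as ℚP
  open import Data.Fin using (Fin; zero; suc)
  import Data.List.Relation.Unary.All as All
  import Data.List.Relation.Unary.All.Properties as AllP
  open import Data.Product using (_×_; _,_)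
  open import Function.Bundles using (_⇔_; mk⇔)
  open import Algebra.Bundles using (CommutativeRing)
  import Algebra.Properties.Semiring.Sum as SemiringSum
  open import Relation.Binary.PropositionalEquality

  module Sums = SemiringSum (CommutativeRing.semiring ℚP.+-*-commutativeRing)

  -- The finite sums of Defs are the library's semiring sums, so the library's
  -- properties (congruence, distributivity, interchange) apply to them.
  sumℚ≡sum : ∀ {m} (f : Fin m → ℚ) → sumℚ f ≡ Sums.sum f
  sumℚ≡sum {zero}  f = refl
  sumℚ≡sum {suc m} f = cong (f zero ℚ.+_) (sumℚ≡sum (λ i → f (suc i)))

  sumℚ-cong : ∀ {m} {f g : Fin m → ℚ} → f ≗ g → sumℚ f ≡ sumℚ g
  sumℚ-cong {f = f} {g} f≗g = trans (sumℚ≡sum f) (trans (Sums.sum-cong-≗ f≗g) (sym (sumℚ≡sum g)))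

  ι-sum : ∀ {m} (f : Fin m → ℤ) → ι (sumℤ f) ≡ sumℚ (λ j → ι (f j))
  ι-sum {zero}  f = refl
  ι-sum {suc m} f = trans (ι-+ (f zero) _) (cong (ι (f zero) ℚ.+_) (ι-sum (λ j → f (suc j))))

  ι-sum-* : ∀ {m} (f g : Fin m → ℤ) → ι (sumℤ (λ k → f k ℤ.* g k)) ≡ sumℚ (λ k → ι (f k) ℚ.* ι (g k))
  ι-sum-* f g = trans (ι-sum (λ k → f k ℤ.* g k)) (sumℚ-cong (λ k → ι-* (f k) (g k)))

  linear∘affine : ∀ {m n} (u : Fin m → ℚ) (M : Fin m → Fin n → ℚ) (y : Fin n → ℚ) (w : Fin m → ℚ) →
    sumℚ (λ j → sumℚ (λ i → u i ℚ.* M i j) ℚ.* y j) ℚ.+ sumℚ (λ i → u i ℚ.* w i)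
      ≡ sumℚ (λ i → u i ℚ.* (sumℚ (λ j → M i j ℚ.* y j) ℚ.+ w i))
  linear∘affine u M y w = begin
      sumℚ (λ j → sumℚ (λ i → u i ℚ.* M i j) ℚ.* y j) ℚ.+ sumℚ (λ i → u i ℚ.* w i)
        ≡⟨ cong₂ ℚ._+_ (trans (sumℚ≡sum (λ j → sumℚ (λ i → u i ℚ.* M i j) ℚ.* y j)) (Sums.sum-cong-≗ (λ j → cong (ℚ._* y j) (sumℚ≡sum (λ i → u i ℚ.* M i j)))))
                        (sumℚ≡sum (λ i → u i ℚ.* w i)) ⟩
      Sums.sum (λ j → Sums.sum (λ i → u i ℚ.* M i j) ℚ.* y j) ℚ.+ Sums.sum (λ i → u i ℚ.* w i)
        ≡⟨ cong (ℚ._+ _) (Sums.sum-cong-≗ (λ j → Sums.*-distribʳ-sum (y j) (λ i → u i ℚ.* M i j))) ⟩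
      Sums.sum (λ j → Sums.sum (λ i → u i ℚ.* M i j ℚ.* y j)) ℚ.+ Sums.sum (λ i → u i ℚ.* w i)
        ≡⟨ cong (ℚ._+ _) (Sums.∑-comm (λ j i → u i ℚ.* M i j ℚ.* y j)) ⟩
      Sums.sum (λ i → Sums.sum (λ j → u i ℚ.* M i j ℚ.* y j)) ℚ.+ Sums.sum (λ i → u i ℚ.* w i)
        ≡⟨ cong (ℚ._+ _) (Sums.sum-cong-≗ (λ i → factor-out i)) ⟩
      Sums.sum (λ i → u i ℚ.* Sums.sum (λ j → M i j ℚ.* y j)) ℚ.+ Sums.sum (λ i → u i ℚ.* w i)
        ≡⟨ Sums.∑-distrib-+ (λ i → u i ℚ.* Sums.sum (λ j → M i j ℚ.* y j)) (λ i → u i ℚ.* w i) ⟨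
      Sums.sum (λ i → u i ℚ.* Sums.sum (λ j → M i j ℚ.* y j) ℚ.+ u i ℚ.* w i)
        ≡⟨ Sums.sum-cong-≗ (λ i → ℚP.*-distribˡ-+ (u i) _ (w i)) ⟨
      Sums.sum (λ i → u i ℚ.* (Sums.sum (λ j → M i j ℚ.* y j) ℚ.+ w i))
        ≡⟨ trans (sumℚ≡sum (λ i → u i ℚ.* (sumℚ (λ j → M i j ℚ.* y j) ℚ.+ w i)))
                 (Sums.sum-cong-≗ (λ i → cong (λ s → u i ℚ.* (s ℚ.+ w i)) (sumℚ≡sum (λ j → M i j ℚ.* y j)))) ⟨
      sumℚ (λ i → u i ℚ.* (sumℚ (λ j → M i j ℚ.* y j) ℚ.+ w i)) ∎
    where
    open ≡-Reasoning
    factor-out : ∀ i → Sums.sum (λ j → u i ℚ.* M i j ℚ.* y j) ≡ u i ℚ.* Sums.sum (λ j → M i j ℚ.* y j)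
    factor-out i = trans (Sums.sum-cong-≗ (λ j → ℚP.*-assoc (u i) (M i j) (y j)))
                         (sym (Sums.*-distribˡ-sum (u i) (λ j → M i j ℚ.* y j)))

  evalAff-cong : ∀ {d} (α : Aff d) {x y : Vecℚ d} → x ≗ y → evalAff α x ≡ evalAff α y
  evalAff-cong α x≗y = cong (ℚ._+ const α) (sumℚ-cong (λ j → cong (coef α j ℚ.*_) (x≗y j)))

  stepℚ : ∀ {d} → Mat d → Vecℤ d → Vecℚ d → Vecℚ d
  stepℚ A a y i = sumℚ (λ j → ι (A i j) ℚ.* y j) ℚ.+ ι (a i)

  stepℚ-cong : ∀ {d} (A : Mat d) (a : Vecℤ d) {x y : Vecℚ d} → x ≗ y → stepℚ A a x ≗ stepℚ A a y
  stepℚ-cong A a x≗y i = cong (ℚ._+ ι (a i)) (sumℚ-cong (λ j → cong (ι (A i j) ℚ.*_) (x≗y j)))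

  castVec-update : ∀ {d} (A : Mat d) (a : Vecℤ d) (z : Vecℤ d) → castVec (update A a z) ≗ stepℚ A a (castVec z)
  castVec-update A a z i = trans (ι-+ (mulMV A z i) (a i)) (cong (ℚ._+ ι (a i)) (ι-sum-* (A i) z))

  chainedUpdate≗step² : ∀ {d} (A : Mat d) (a : Vecℤ d) (y : Vecℚ d) →
                        chainedUpdate A a y ≗ stepℚ A a (stepℚ A a y)
  chainedUpdate≗step² A a y i = begin
      sumℚ (λ j → ι (mulMM A A i j) ℚ.* y j) ℚ.+ ι (mulMV A a i ℤ.+ a i)
        ≡⟨ cong₂ ℚ._+_ (sumℚ-cong (λ j → cong (ℚ._* y j) (ι-sum-* (A i) (λ k → A k j))))
                       (trans (ι-+ (mulMV A a i) (a i)) (cong (ℚ._+ ι (a i)) (ι-sum-* (A i) a))) ⟩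
      sumℚ (λ j → sumℚ (λ k → Aᵢ k ℚ.* ι (A k j)) ℚ.* y j) ℚ.+ (sumℚ (λ k → Aᵢ k ℚ.* ι (a k)) ℚ.+ ι (a i))
        ≡⟨ ℚP.+-assoc (sumℚ (λ j → sumℚ (λ k → Aᵢ k ℚ.* ι (A k j)) ℚ.* y j)) (sumℚ (λ k → Aᵢ k ℚ.* ι (a k))) (ι (a i)) ⟨
      sumℚ (λ j → sumℚ (λ k → Aᵢ k ℚ.* ι (A k j)) ℚ.* y j) ℚ.+ sumℚ (λ k → Aᵢ k ℚ.* ι (a k)) ℚ.+ ι (a i)
        ≡⟨ cong (ℚ._+ ι (a i)) (linear∘affine Aᵢ (λ k j → ι (A k j)) y (λ k → ι (a k))) ⟩
      stepℚ A a (stepℚ A a y) i ∎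
    where
    open ≡-Reasoning
    Aᵢ : Fin _ → ℚ
    Aᵢ k = ι (A i k)

  evalAff-substAff : ∀ {d} (A : Mat d) (a : Vecℤ d) (α : Aff d) (y : Vecℚ d) →
                     evalAff (substAff A a α) y ≡ evalAff α (stepℚ A a y)
  evalAff-substAff A a α y = begin
      sumℚ (λ j → sumℚ (λ i → coef α i ℚ.* ι (A i j)) ℚ.* y j) ℚ.+ (sumℚ (λ i → coef α i ℚ.* ι (a i)) ℚ.+ const α)
        ≡⟨ ℚP.+-assoc (sumℚ (λ j → sumℚ (λ i → coef α i ℚ.* ι (A i j)) ℚ.* y j)) (sumℚ (λ i → coef α i ℚ.* ι (a i))) (const α) ⟨
      sumℚ (λ j → sumℚ (λ i → coef α i ℚ.* ι (A i j)) ℚ.* y j) ℚ.+ sumℚ (λ i → coef α i ℚ.* ι (a i)) ℚ.+ const α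
        ≡⟨ cong (ℚ._+ const α) (linear∘affine (coef α) (λ i j → ι (A i j)) y (λ i → ι (a i))) ⟩
      evalAff α (stepℚ A a y) ∎
    where open ≡-Reasoning

  Holds-cong : ∀ {d} (φ : Guard d) {x y : Vecℚ d} → x ≗ y → Holds φ x → Holds φ y
  Holds-cong φ x≗y = All.map (λ {α} → subst (0ℚ ℚ.<_) (evalAff-cong α x≗y))

  chainedGuard-holds : ∀ {d} (A : Mat d) (a : Vecℤ d) (φ : Guard d) (y : Vecℚ d) →
                       Holds (chainedGuard A a φ) y ⇔ (Holds φ y × Holds φ (stepℚ A a y))
  chainedGuard-holds A a φ y = mk⇔
    (λ h → AllP.++⁻ˡ φ h , All.map (λ {α} → subst (0ℚ ℚ.<_) (evalAff-substAff A a α y)) (AllP.map⁻ (AllP.++⁻ʳ φ h)))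
    (λ (now , next) → AllP.++⁺ now (AllP.map⁺ (All.map (λ {α} → subst (0ℚ ℚ.<_) (sym (evalAff-substAff A a α y))) next)))


module Orbits where

  open Asymptotics using (Eventually; ev-map; ev-and; ev-all)
  open LoopSemantics
  open import Data.Nat as ℕ using (ℕ; zero; suc)
  import Data.Nat.Properties as ℕP
  open import Data.Fin using (Fin)
  open import Data.List using (List; lookup)
  open import Data.List.Relation.Unary.All using (All)
  import Data.List.Relation.Unary.All as All
  open import Data.List.Relation.Unary.Any using (index)
  open import Data.List.Relation.Unary.Any.Properties using (lookup-index)
  open import Data.List.Membership.Propositional.Properties using (∈-lookup)
  open import Data.Product using (Σ; _×_; _,_; proj₁; proj₂)
  open import Data.Product.Function.NonDependent.Propositional using (_×-⇔_)
  open import Data.Sum using (_⊎_; inj₁; inj₂)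
  open import Function.Bundles using (_⇔_; mk⇔; Equivalence)
  import Function.Properties.Equivalence as ⇔
  open import Relation.Binary.PropositionalEquality

  open Equivalence using (to; from)

  eventually-cong : ∀ {P Q : ℕ → Set} → Eventually (λ n → P n ⇔ Q n) → Eventually P ⇔ Eventually Q
  eventually-cong P⇔Q = mk⇔ (λ evP → ev-map (λ n (e , p) → to e p) (ev-and P⇔Q evP))
                            (λ evQ → ev-map (λ n (e , q) → from e q) (ev-and P⇔Q evQ))

  eventually-∀ : ∀ {m} {P : Fin m → ℕ → Set} → Eventually (λ n → ∀ i → P i n) ⇔ (∀ i → Eventually (P i))
  eventually-∀ = mk⇔ (λ ev i → ev-map (λ n all → all i) ev) ev-all

  ∀-⇔ : ∀ {m} {P Q : Fin m → Set} → (∀ i → P i ⇔ Q i) → (∀ i → P i) ⇔ (∀ i → Q i)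
  ∀-⇔ P⇔Q = mk⇔ (λ ps i → to (P⇔Q i) (ps i)) (λ qs i → from (P⇔Q i) (qs i))

  All⇔lookup : ∀ {A : Set} {P : A → Set} (xs : List A) → All P xs ⇔ (∀ i → P (lookup xs i))
  All⇔lookup {P = P} xs =
    mk⇔ (λ all i → All.lookup all (∈-lookup i))
        (λ ps → All.tabulate (λ x∈xs → subst P (sym (lookup-index x∈xs)) (ps (index x∈xs))))

  -- Doubling, defined so that iterating twice more is definitional:
  -- double (suc m) = suc (suc (double m)).
  double : ℕ → ℕ
  double zero    = zero
  double (suc m) = suc (suc (double m))

  n≤double : ∀ n → n ℕ.≤ double n
  n≤double zero    = ℕ.z≤n
  n≤double (suc n) = ℕ.s≤s (ℕP.m≤n⇒m≤1+n (n≤double n))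

  parity : ∀ k → Σ ℕ λ m → k ≡ double m ⊎ k ≡ suc (double m)
  parity zero = 0 , inj₁ refl
  parity (suc k) with parity k
  ... | m , inj₁ k≡2m  = m , inj₂ (cong suc k≡2m)
  ... | m , inj₂ k≡2m+1 = suc m , inj₁ (cong suc k≡2m+1)

  double-cancel-≤ : ∀ M m → double M ℕ.≤ suc (double m) → M ℕ.≤ m
  double-cancel-≤ zero    m       _                       = ℕ.z≤n
  double-cancel-≤ (suc M) zero    (ℕ.s≤s ())
  double-cancel-≤ (suc M) (suc m) (ℕ.s≤s (ℕ.s≤s le)) = ℕ.s≤s (double-cancel-≤ M m le)

  eventually-even-odd : ∀ (P : ℕ → Set) →
    (Σ ℕ λ n₀ → ∀ n → n₀ ℕ.< n → P n) ⇔ Eventually (λ m → P (double m) × P (suc (double m)))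
  eventually-even-odd P = mk⇔ split merge
    where
    split : (Σ ℕ λ n₀ → ∀ n → n₀ ℕ.< n → P n) → Eventually (λ m → P (double m) × P (suc (double m)))
    split (n₀ , large) = suc n₀ , λ m n₀<m → let n₀<2m = ℕP.≤-trans n₀<m (n≤double m) in
      large (double m) n₀<2m , large (suc (double m)) (ℕP.m<n⇒m<1+n n₀<2m)
    merge : Eventually (λ m → P (double m) × P (suc (double m))) → Σ ℕ λ n₀ → ∀ n → n₀ ℕ.< n → P n
    merge (M , both) = double M , large
      where
      large : ∀ k → double M ℕ.< k → P k
      large k 2M<k with parity k
      ... | m , inj₁ refl = proj₁ (both m (double-cancel-≤ M m (ℕP.m<n⇒m≤1+n 2M<k)))
      ... | m , inj₂ refl = proj₂ (both m (double-cancel-≤ M m (ℕP.<⇒≤ 2M<k)))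

  iter-intertwine : ∀ {A B C : Set} (f : A → A) (g : (B → C) → (B → C)) (e : A → (B → C)) →
    (∀ {x y} → x ≗ y → g x ≗ g y) → (∀ x → e (f x) ≗ g (e x)) →
    ∀ k x → e (iter f k x) ≗ iter g k (e x)
  iter-intertwine f g e g-cong e∘f≗g∘e zero    x = λ _ → refl
  iter-intertwine f g e g-cong e∘f≗g∘e (suc k) x =
    λ i → trans (e∘f≗g∘e (iter f k x) i) (g-cong (iter-intertwine f g e g-cong e∘f≗g∘e k x) i)

  iter-square : ∀ {B C : Set} (g h : (B → C) → (B → C)) →
    (∀ {x y} → x ≗ y → g x ≗ g y) → (∀ x → h x ≗ g (g x)) →
    ∀ m x → iter h m x ≗ iter g (double m) x
  iter-square g h g-cong h≗g² zero    x = λ _ → refl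
  iter-square g h g-cong h≗g² (suc m) x =
    λ i → trans (h≗g² (iter h m x) i) (g-cong (g-cong (iter-square g h g-cong h≗g² m x)) i)

  Holds-cong⇔ : ∀ {d} (φ : Guard d) {x y : Vecℚ d} → x ≗ y → Holds φ x ⇔ Holds φ y
  Holds-cong⇔ φ x≗y = mk⇔ (Holds-cong φ x≗y) (Holds-cong φ (λ i → sym (x≗y i)))

  witness⇔chainedOrbit : ∀ {d} (A : Mat d) (a : Vecℤ d) (φ : Guard d) (c : Vecℤ d) →
    WitnessesENT A a φ c ⇔ Eventually (λ m → Holds (chainedGuard A a φ) (iter (chainedUpdate A a) m (castVec c)))
  witness⇔chainedOrbit A a φ c =
    ⇔.trans (eventually-even-odd (λ k → Holds φ (castVec (iter (update A a) k c))))
            (eventually-cong (0 , λ m _ → even-odd⇔chained m))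
    where
    orbit : ℕ → Vecℚ _
    orbit k = iter (stepℚ A a) k (castVec c)
    orbit-cast : ∀ k → castVec (iter (update A a) k c) ≗ orbit k
    orbit-cast k = iter-intertwine (update A a) (stepℚ A a) castVec (stepℚ-cong A a) (castVec-update A a) k c
    even-odd⇔chained : ∀ m → (Holds φ (castVec (iter (update A a) (double m) c))
                              × Holds φ (castVec (iter (update A a) (suc (double m)) c)))
                             ⇔ Holds (chainedGuard A a φ) (iter (chainedUpdate A a) m (castVec c))
    even-odd⇔chained m =
      ⇔.trans (Holds-cong⇔ φ (orbit-cast (double m)) ×-⇔ Holds-cong⇔ φ (orbit-cast (suc (double m))))
      (⇔.trans (⇔.sym (chainedGuard-holds A a φ (orbit (double m))))
               (Holds-cong⇔ (chainedGuard A a φ)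
                  (λ i → sym (iter-square (stepℚ A a) (chainedUpdate A a) (stepℚ-cong A a) (chainedUpdate≗step² A a) m (castVec c) i))))


open import Level using (0ℓ)
open import Data.Product using (_,_; proj₂)
open import Data.Rational using (0ℚ; _<_)
open import Data.List.Relation.Unary.AllPairs using (AllPairs)
open import Data.List.Relation.Unary.Linked.Properties using (Linked⇒AllPairs)
open import Function.Base using (_∘_)
open import Function.Bundles using (mk⇔)
import Function.Properties.Equivalence as ⇔
open import Relation.Binary.PropositionalEquality using (sym; trans; subst)

open Asymptotics using (Eventually; ev-map; ev-all; >lex-trans)
open SignOfNPE using (EventuallyPositive; eventuallyPositive⇔lia)
open Normalization using (normalize-eventually)
open LoopSemantics using (evalAff-cong)
open Orbits using (eventually-cong; eventually-∀; ∀-⇔; All⇔lookup; witness⇔chainedOrbit)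

lemma11 : ∀ {d : ℕ} (A : Mat d) (a : Vecℤ d) (φ : Guard d) →
    Triangular A →
    (q : Fin d → PE d) → ClosedForm (chainedUpdate A a) q →
    (ps : Fin (length (chainedGuard A a φ)) → NPE d) →
    (∀ i → OrderedNPE (ps i)) →
    (∀ i (x : Vecℚ d) (n : ℕ) →
       evalNPE (ps i) x n
         ≡ evalAff (lookup (chainedGuard A a φ) i) (λ j → evalNPE (normalize (q j)) x n)) →
    (c : Vecℤ d) →
    WitnessesENT A a φ c ⇔ (∀ i → Lia (ps i) (castVec c))
lemma11 {d} A a φ _ q closed ps ordered pᵢ-def c = begin
    WitnessesENT A a φ c                                             ≈⟨ witness⇔chainedOrbit A a φ c ⟩
    Eventually (λ n → Holds G (orbit n))                             ≈⟨ eventually-cong (0 , λ n _ → All⇔lookup G) ⟩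
    Eventually (λ n → ∀ i → 0ℚ < evalAff (lookup G i) (orbit n))     ≈⟨ eventually-cong (ev-map (λ n → ∀-⇔ ∘ sign-agrees n) pᵢ-on-orbit) ⟩
    Eventually (λ n → ∀ i → 0ℚ < evalNPE (ps i) y n)                 ≈⟨ eventually-∀ ⟩
    (∀ i → EventuallyPositive y (ps i))                              ≈⟨ ∀-⇔ (λ i → eventuallyPositive⇔lia y (ps i) (ordered-pairs i)) ⟩
    (∀ i → Lia (ps i) y)                                             ∎
  where
  open import Relation.Binary.Reasoning.Setoid (⇔.⇔-setoid 0ℓ)
  G : Guard d
  G = chainedGuard A a φ
  y : Vecℚ d
  y = castVec c
  orbit : ℕ → Vecℚ d
  orbit n = iter (chainedUpdate A a) n y
  -- for large n, normalization is exact, so pᵢ(n) is the i-th atom of G on the orbit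
  pᵢ-on-orbit : Eventually (λ n → ∀ i → evalAff (lookup G i) (orbit n) ≡ evalNPE (ps i) y n)
  pᵢ-on-orbit = ev-map (λ n normalized i → sym (trans (pᵢ-def i y n)
                  (evalAff-cong (lookup G i) (λ j → trans (normalized j y) (closed n y j)))))
                (ev-all (λ j → normalize-eventually (q j)))
  sign-agrees : ∀ n → (∀ i → evalAff (lookup G i) (orbit n) ≡ evalNPE (ps i) y n) →
                ∀ i → (0ℚ < evalAff (lookup G i) (orbit n)) ⇔ (0ℚ < evalNPE (ps i) y n)
  sign-agrees n eq i = mk⇔ (subst (0ℚ <_) (eq i)) (subst (0ℚ <_) (sym (eq i)))
  ordered-pairs : ∀ i → AllPairs _>lex_ (ps i)
  ordered-pairs i = Linked⇒AllPairs (λ {s} {t} {u} → >lex-trans {d} {s} {t} {u}) (proj₂ (ordered i))
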